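{- Let $G$ be a connected graph of order $n$ with maximum degree $\Delta(G)=3$. Then $\iota(G,B_2)\leq \frac{n}{5}$, unless $G$ is isomorphic to $B_2$ or to $K_4$.
   Context: All graphs are finite and simple. For $S\subseteq V(G)$, $N[S]$ denotes the closed neighborhood of $S$. $B_2$ denotes the diamond graph, i.e. $K_4$ with one edge deleted. A set $S\subseteq V(G)$ is a $B_2$-isolating set of $G$ if the subgraph of $G$ induced by $V(G)\setminus N[S]$ contains no subgraph isomorphic to $B_2$; $\iota(G,B_2)$ is the minimum cardinality of a $B_2$-isolating set of $G$. -}

module Defs where

open import Data.Nat using (ℕ; _≤_; _*_)
open import Data.Fin using (Fin; zero; suc)
open import Data.Fin.Subset using (Subset; _∈_; _∉_; ∣_∣)
open import Data.Bool using (Bool; true; false; T)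
open import Data.List using (List; []; _∷_; filter; length)
open import Data.List using () renaming (allFin to allFinL)
open import Data.Product using (Σ; ∃; _×_; _,_)
open import Data.Sum using (_⊎_)
open import Relation.Nullary using (¬_)
open import Relation.Binary.PropositionalEquality using (_≡_; _≢_)
open import Data.Fin.Properties using (_≟_)
open import Function.Bundles using (_↔_; Inverse)

record Graph (n : ℕ) : Set where
  field
    adj   : Fin n → Fin n → Bool
    sym   : ∀ u v → adj u v ≡ adj v u
    irref : ∀ v → adj v v ≡ false
open Graph public

Adj : ∀ {n} → Graph n → Fin n → Fin n → Set
Adj G u v = T (adj G u v)

degree : ∀ {n} → Graph n → Fin n → ℕ
degree {n} G v = length (filter (λ u → Data.Bool._≟_ (adj G v u) true) (allFinL n))

MaxDegree3 : ∀ {n} → Graph n → Set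
MaxDegree3 {n} G = (∀ v → degree G v ≤ 3) × (∃ λ v → degree G v ≡ 3)

data Walk {n} (G : Graph n) : Fin n → Fin n → Set where
  here : ∀ {v} → Walk G v v
  step : ∀ {u w v} → Adj G u w → Walk G w v → Walk G u v

Connected : ∀ {n} → Graph n → Set
Connected {n} G = Fin n × (∀ u v → Walk G u v)

InClosedNbhd : ∀ {n} → Graph n → Subset n → Fin n → Set
InClosedNbhd G S v = v ∈ S ⊎ ∃ λ u → u ∈ S × Adj G u v

-- G - N[S] contains a subgraph isomorphic to the diamond B₂ (= K₄ minus an edge):
-- four distinct vertices a b c d outside N[S] with edges ab, ac, ad, bc, bd
-- (the edge cd may or may not be present).
HasDiamondOutside : ∀ {n} → Graph n → Subset n → Set
HasDiamondOutside {n} G S =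
  Σ (Fin n) λ a → Σ (Fin n) λ b → Σ (Fin n) λ c → Σ (Fin n) λ d →
    (a ≢ b) × (a ≢ c) × (a ≢ d) × (b ≢ c) × (b ≢ d) × (c ≢ d) ×
    ¬ InClosedNbhd G S a × ¬ InClosedNbhd G S b ×
    ¬ InClosedNbhd G S c × ¬ InClosedNbhd G S d ×
    Adj G a b × Adj G a c × Adj G a d × Adj G b c × Adj G b d

IsB₂Isolating : ∀ {n} → Graph n → Subset n → Set
IsB₂Isolating G S = ¬ HasDiamondOutside G S

record _≅_ {m n} (G : Graph m) (H : Graph n) : Set where
  field
    iso      : Fin m ↔ Fin n
    preserve : ∀ u v → adj G u v ≡ adj H (Inverse.to iso u) (Inverse.to iso v)

K4adj : Fin 4 → Fin 4 → Bool
K4adj u v with u ≟ v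
... | Relation.Nullary.yes _ = false
... | Relation.Nullary.no _ = true

isE23 : Fin 4 → Fin 4 → Bool
isE23 (suc (suc zero)) (suc (suc (suc zero))) = true
isE23 (suc (suc (suc zero))) (suc (suc zero)) = true
isE23 _ _ = false

B2adj : Fin 4 → Fin 4 → Bool
B2adj u v with isE23 u v
... | true = false
... | false = K4adj u v

private
  f0 f1 f2 f3 : Fin 4
  f0 = zero
  f1 = suc zero
  f2 = suc (suc zero)
  f3 = suc (suc (suc zero))

K4-sym : ∀ u v → K4adj u v ≡ K4adj v u
K4-sym zero zero = Relation.Binary.PropositionalEquality.refl
K4-sym zero (suc zero) = Relation.Binary.PropositionalEquality.refl
K4-sym zero (suc (suc zero)) = Relation.Binary.PropositionalEquality.refl
K4-sym zero (suc (suc (suc zero))) = Relation.Binary.PropositionalEquality.refl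
K4-sym (suc zero) zero = Relation.Binary.PropositionalEquality.refl
K4-sym (suc zero) (suc zero) = Relation.Binary.PropositionalEquality.refl
K4-sym (suc zero) (suc (suc zero)) = Relation.Binary.PropositionalEquality.refl
K4-sym (suc zero) (suc (suc (suc zero))) = Relation.Binary.PropositionalEquality.refl
K4-sym (suc (suc zero)) zero = Relation.Binary.PropositionalEquality.refl
K4-sym (suc (suc zero)) (suc zero) = Relation.Binary.PropositionalEquality.refl
K4-sym (suc (suc zero)) (suc (suc zero)) = Relation.Binary.PropositionalEquality.refl
K4-sym (suc (suc zero)) (suc (suc (suc zero))) = Relation.Binary.PropositionalEquality.refl
K4-sym (suc (suc (suc zero))) zero = Relation.Binary.PropositionalEquality.refl
K4-sym (suc (suc (suc zero))) (suc zero) = Relation.Binary.PropositionalEquality.refl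
K4-sym (suc (suc (suc zero))) (suc (suc zero)) = Relation.Binary.PropositionalEquality.refl
K4-sym (suc (suc (suc zero))) (suc (suc (suc zero))) = Relation.Binary.PropositionalEquality.refl

B2-sym : ∀ u v → B2adj u v ≡ B2adj v u
B2-sym zero zero = Relation.Binary.PropositionalEquality.refl
B2-sym zero (suc zero) = Relation.Binary.PropositionalEquality.refl
B2-sym zero (suc (suc zero)) = Relation.Binary.PropositionalEquality.refl
B2-sym zero (suc (suc (suc zero))) = Relation.Binary.PropositionalEquality.refl
B2-sym (suc zero) zero = Relation.Binary.PropositionalEquality.refl
B2-sym (suc zero) (suc zero) = Relation.Binary.PropositionalEquality.refl
B2-sym (suc zero) (suc (suc zero)) = Relation.Binary.PropositionalEquality.refl
B2-sym (suc zero) (suc (suc (suc zero))) = Relation.Binary.PropositionalEquality.refl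
B2-sym (suc (suc zero)) zero = Relation.Binary.PropositionalEquality.refl
B2-sym (suc (suc zero)) (suc zero) = Relation.Binary.PropositionalEquality.refl
B2-sym (suc (suc zero)) (suc (suc zero)) = Relation.Binary.PropositionalEquality.refl
B2-sym (suc (suc zero)) (suc (suc (suc zero))) = Relation.Binary.PropositionalEquality.refl
B2-sym (suc (suc (suc zero))) zero = Relation.Binary.PropositionalEquality.refl
B2-sym (suc (suc (suc zero))) (suc zero) = Relation.Binary.PropositionalEquality.refl
B2-sym (suc (suc (suc zero))) (suc (suc zero)) = Relation.Binary.PropositionalEquality.refl
B2-sym (suc (suc (suc zero))) (suc (suc (suc zero))) = Relation.Binary.PropositionalEquality.refl

K4-irr : ∀ v → K4adj v v ≡ false
K4-irr zero = Relation.Binary.PropositionalEquality.refl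
K4-irr (suc zero) = Relation.Binary.PropositionalEquality.refl
K4-irr (suc (suc zero)) = Relation.Binary.PropositionalEquality.refl
K4-irr (suc (suc (suc zero))) = Relation.Binary.PropositionalEquality.refl

B2-irr : ∀ v → B2adj v v ≡ false
B2-irr zero = Relation.Binary.PropositionalEquality.refl
B2-irr (suc zero) = Relation.Binary.PropositionalEquality.refl
B2-irr (suc (suc zero)) = Relation.Binary.PropositionalEquality.refl
B2-irr (suc (suc (suc zero))) = Relation.Binary.PropositionalEquality.refl

K₄ : Graph 4
K₄ = record { adj = K4adj ; sym = K4-sym ; irref = K4-irr }

B₂ : Graph 4
B₂ = record { adj = B2adj ; sym = B2-sym ; irref = B2-irr }

module Submission where

-- Call the two degree-3 vertices a, b of a diamond its hubs and the other two c, d its tips.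
-- In a connected subcubic graph other than K₄ every diamond is induced, the hubs have no
-- neighbours outside it, and each tip has at most one further neighbour, its exit, which is
-- not a hub; a vertex is a hub (or a tip) of at most one diamond. Colour the vertices greedily
-- with five colours, first the vertices lying on no diamond, then the tips, then the hubs, so
-- that on every diamond the two tips, an exit and the two hubs get five different colours: a tip
-- has to avoid at most four colours (its mate, its exit, the exit of its mate, the mate of its
-- exit) and so has a hub (both tips, one exit, the other hub). Then every colour occurs in the
-- closed neighbourhood of each tip pair, so every colour class is B₂-isolating unless some
-- diamond has no exit, in which case connectivity forces G ≅ B₂. The smallest of the five
-- colour classes has at most n/5 vertices.

open import Defs hiding (sym)
open import Data.Nat using (ℕ; zero; suc; _≤_; _<_; _*_; _+_; z≤n; s≤s)
open import Data.Nat.Properties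
  using (≮⇒≥; +-mono-≤; ≤-refl; ≤-trans; ≤-total; <-irrefl; ≤∧≢⇒<; ≤-pred; <-cmp; +-0-commutativeMonoid)
  renaming (_≟_ to _≟ℕ_)
open import Data.Bool using (true; false; T; if_then_else_)
import Data.Bool as Bool
open import Data.Bool.Properties using (T-≡)
open import Data.Fin using (Fin; zero; suc; toℕ; combine) renaming (_<_ to _<ᶠ_)
open import Data.Fin.Patterns using (0F; 1F; 2F; 3F)
open import Data.Fin.Properties
  using (_≟_; any?; pigeonhole; ¬∀⟶∃¬; <⇒≢; toℕ-injective; combine-injectiveʳ; combine-monoˡ-<)
  renaming (_<?_ to _<ᶠ?_; <-cmp to <ᶠ-cmp; <-asym to <ᶠ-asym)
open import Data.Fin.Subset using (Subset; ∣_∣) renaming (_∈_ to _∈ₛ_)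
open import Data.List using (filter) renaming (allFin to allFinL)
open import Data.List.Membership.Propositional.Properties using (∈-filter⁺; ∈-allFin)
open import Data.Vec using (Vec; []; _∷_; lookup; tabulate; map; fromList)
open import Data.Vec.Properties using (lookup⇒[]=; lookup∘tabulate)
open import Data.Vec.Membership.Propositional using (_∈_; _∉_)
open import Data.Vec.Membership.Propositional.Properties using (∈-lookup; ∈-allFin⁺; ∈-map⁺; ∈-fromList⁺)
import Data.Vec.Membership.DecPropositional as DecMembership
open import Data.Vec.Relation.Unary.Any using (Any; here; there; index)
open import Data.Vec.Relation.Unary.Any.Properties as Any using (lookup-index)
open import Data.Vec.Relation.Unary.All using (All; []; _∷_)
open import Data.Vec.Relation.Unary.AllPairs using ([]; _∷_)
open import Data.Vec.Relation.Unary.Unique.Propositional using (Unique)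
open import Data.Vec.Relation.Unary.Unique.Propositional.Properties using (lookup-injective; tabulate⁺)
open import Data.Empty using (⊥; ⊥-elim)
open import Data.Product using (Σ; ∃; _×_; _,_; proj₁; proj₂; swap)
import Data.Product as Product
open import Data.Sum using (_⊎_; inj₁; inj₂)
import Data.Sum as Sum
open import Function using (_∘_)
open import Function.Bundles using (Equivalence; _↔_; mk↔ₛ′)
open import Relation.Nullary using (¬_; Dec; yes; no; does; contradiction)
open import Relation.Nullary.Decidable using (T?; ¬?; map′; _×-dec_; _⊎-dec_; dec-true; dec-false)
open import Relation.Binary.Definitions using (Tri; tri<; tri≈; tri>)
open import Relation.Binary.PropositionalEquality
  using (_≡_; _≢_; refl; sym; trans; cong; cong₂; subst; subst₂; ≢-sym; module ≡-Reasoning)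
open import Algebra.Properties.CommutativeMonoid.Sum +-0-commutativeMonoid
  using (sum; ∑-distrib-+; sum-cong-≗; sum-replicate-zero)

private variable
  A : Set
  m n k : ℕ

-- Counting

unique-⊆⇒≤ : {ys : Vec A m} {xs : Vec A n} → Unique ys → (∀ {y} → y ∈ ys → y ∈ xs) → m ≤ n
unique-⊆⇒≤ {m = m} {n = n} {ys = ys} {xs} ys-unique ys⊆xs = ≮⇒≥ too-small
  where
  position : Fin m → Fin n
  position i = index (ys⊆xs (∈-lookup i ys))

  position-correct : ∀ i → lookup ys i ≡ lookup xs (position i)
  position-correct i = lookup-index (ys⊆xs (∈-lookup i ys))

  too-small : ¬ n < m
  too-small n<m with i , j , i<j , same ← pigeonhole n<m position =
    <⇒≢ i<j (lookup-injective ys-unique i j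
      (trans (position-correct i) (trans (cong (lookup xs) same) (sym (position-correct j)))))

missing-colour : (cs : Vec (Fin (suc k)) k) → ∃ λ c → c ∉ cs
missing-colour {k} cs = ¬∀⟶∃¬ (suc k) (_∈ cs) (λ c → DecMembership._∈?_ _≟_ c cs) λ covered →
  <-irrefl refl (unique-⊆⇒≤ (tabulate⁺ (λ same → same)) (λ {c} _ → covered c))

∉⇒All≢ : {x : A} {xs : Vec A n} → x ∉ xs → All (x ≢_) xs
∉⇒All≢ {xs = []} _ = []
∉⇒All≢ {xs = y ∷ ys} x∉ = x∉ ∘ here ∷ ∉⇒All≢ (x∉ ∘ there)

unique-complete : {xs : Vec (Fin n) n} → Unique xs → ∀ i → i ∈ xs
unique-complete {xs = xs} xs-unique i with DecMembership._∈?_ _≟_ i xs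
... | yes i∈xs = i∈xs
... | no i∉xs = contradiction
  (unique-⊆⇒≤ {ys = i ∷ xs} (∉⇒All≢ i∉xs ∷ xs-unique) (λ {y} _ → ∈-allFin⁺ y)) (<-irrefl refl)

enumeration-↔ : {xs : Vec A n} → Unique xs → (∀ x → x ∈ xs) → A ↔ Fin n
enumeration-↔ {xs = xs} xs-unique complete = mk↔ₛ′ (index ∘ complete) (lookup xs)
  (λ i → lookup-injective xs-unique _ i (sym (lookup-index (complete (lookup xs i)))))
  (λ x → sym (lookup-index (complete x)))

colourClass : (Fin m → Fin k) → Fin k → Subset m
colourClass col i = tabulate (λ v → does (col v ≟ i))

∈-colourClass : ∀ {col : Fin m → Fin k} {v i} → col v ≡ i → v ∈ₛ colourClass col i
∈-colourClass {col = col} {v} {i} v-coloured =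
  lookup⇒[]= v _ (trans (lookup∘tabulate (λ u → does (col u ≟ i)) v) (dec-true (col v ≟ i) v-coloured))

indicator : Fin k → Fin k → ℕ
indicator j i = if does (j ≟ i) then 1 else 0

sum-indicator : ∀ (j : Fin k) → sum (indicator j) ≡ 1
sum-indicator {suc k} zero = cong suc (sum-replicate-zero k)
sum-indicator {suc k} (suc j) = sum-indicator j

∣colourClass∣-step : ∀ (col : Fin (suc m) → Fin k) i →
  ∣ colourClass col i ∣ ≡ indicator (col zero) i + ∣ colourClass (col ∘ suc) i ∣
∣colourClass∣-step col i with does (col zero ≟ i)
... | true = refl
... | false = refl

sum-∣colourClass∣ : ∀ (col : Fin m → Fin k) → sum (λ i → ∣ colourClass col i ∣) ≡ m
sum-∣colourClass∣ {zero} {k} col = sum-replicate-zero k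
sum-∣colourClass∣ {suc m} col = begin
  sum (λ i → ∣ colourClass col i ∣)
    ≡⟨ sum-cong-≗ (∣colourClass∣-step col) ⟩
  sum (λ i → indicator (col zero) i + ∣ colourClass (col ∘ suc) i ∣)
    ≡⟨ ∑-distrib-+ (indicator (col zero)) _ ⟩
  sum (indicator (col zero)) + sum (λ i → ∣ colourClass (col ∘ suc) i ∣)
    ≡⟨ cong₂ _+_ (sum-indicator (col zero)) (sum-∣colourClass∣ (col ∘ suc)) ⟩
  suc m ∎
  where open ≡-Reasoning

argmin : (g : Fin (suc k) → ℕ) → ∃ λ i → ∀ j → g i ≤ g j
argmin {zero} g = zero , λ { zero → ≤-refl }
argmin {suc k} g with i , gi≤ ← argmin (g ∘ suc) | ≤-total (g zero) (g (suc i))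
... | inj₁ g0≤gi = zero , λ { zero → ≤-refl ; (suc j) → ≤-trans g0≤gi (gi≤ j) }
... | inj₂ gi≤g0 = suc i , λ { zero → gi≤g0 ; (suc j) → gi≤ j }

pointwise-≤⇒*≤sum : ∀ {x} (g : Fin k → ℕ) → (∀ j → x ≤ g j) → k * x ≤ sum g
pointwise-≤⇒*≤sum {zero} g x≤ = z≤n
pointwise-≤⇒*≤sum {suc k} g x≤ = +-mono-≤ (x≤ zero) (pointwise-≤⇒*≤sum (g ∘ suc) (x≤ ∘ suc))

smallest-colourClass : ∀ (col : Fin m → Fin (suc k)) → ∃ λ i → suc k * ∣ colourClass col i ∣ ≤ m
smallest-colourClass {m} {k} col with i , minimal ← argmin (λ i → ∣ colourClass col i ∣) =
  i , subst (suc k * ∣ colourClass col i ∣ ≤_) (sum-∣colourClass∣ col)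
            (pointwise-≤⇒*≤sum (λ i → ∣ colourClass col i ∣) minimal)

-- Greedy colouring

module GreedyColouring {V : Set} {k : ℕ} (rank : V → ℕ) (conflicts : V → Vec V k) where

  -- After stage r exactly the vertices of rank below r carry their final colour.
  colourUpTo : ℕ → V → Fin (suc k)
  colourUpTo zero v = zero
  colourUpTo (suc r) v with rank v ≟ℕ r
  ... | yes _ = proj₁ (missing-colour (map (colourUpTo r) (conflicts v)))
  ... | no _ = colourUpTo r v

  colour : V → Fin (suc k)
  colour v = colourUpTo (suc (rank v)) v

  colour-fresh : ∀ v → colour v ≡ proj₁ (missing-colour (map (colourUpTo (rank v)) (conflicts v)))
  colour-fresh v with rank v ≟ℕ rank v
  ... | yes _ = refl
  ... | no r≢r = contradiction refl r≢r

  colourUpTo-stable : ∀ r v → rank v < r → colourUpTo r v ≡ colour v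
  colourUpTo-stable (suc r) v rv<1+r with rank v ≟ℕ r
  ... | yes refl = sym (colour-fresh v)
  ... | no rv≢r = colourUpTo-stable r v (≤∧≢⇒< (≤-pred rv<1+r) rv≢r)

  colour-proper : ∀ {u v} → u ∈ conflicts v → rank u < rank v → colour u ≢ colour v
  colour-proper {u} {v} u∈ ru<rv same = proj₂ (missing-colour earlier) (subst (_∈ earlier)
    (trans (colourUpTo-stable (rank v) u ru<rv) (trans same (colour-fresh v)))
    (∈-map⁺ (colourUpTo (rank v)) u∈))
    where
    earlier : Vec (Fin (suc k)) k
    earlier = map (colourUpTo (rank v)) (conflicts v)

  colour-separates : ∀ {u v} → u ∈ conflicts v → v ∈ conflicts u → rank u ≢ rank v →
    colour u ≢ colour v
  colour-separates {u} {v} u∈ v∈ ru≢rv with <-cmp (rank u) (rank v)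
  ... | tri< ru<rv _ _ = colour-proper u∈ ru<rv
  ... | tri≈ _ ru≡rv _ = contradiction ru≡rv ru≢rv
  ... | tri> _ _ rv<ru = ≢-sym (colour-proper v∈ rv<ru)

-- Diamonds in subcubic graphs

module Subcubic {n} (G : Graph n) (subcubic : ∀ v → degree G v ≤ 3) where

  infix 4 _~_
  _~_ : Fin n → Fin n → Set
  _~_ = Adj G

  _~?_ : ∀ u v → Dec (u ~ v)
  u ~? v = T? (adj G u v)

  ~-sym : ∀ {u v} → u ~ v → v ~ u
  ~-sym {u} {v} = subst T (Graph.sym G u v)

  ~-irrefl : ∀ {v} → ¬ v ~ v
  ~-irrefl {v} = subst T (irref G v)

  ~⇒≢ : ∀ {u v} → u ~ v → u ≢ v
  ~⇒≢ u~u refl = ~-irrefl u~u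

  no-four-neighbours : ∀ {v w x y z} → v ~ w → v ~ x → v ~ y → v ~ z →
    w ≢ x → w ≢ y → w ≢ z → x ≢ y → x ≢ z → y ≢ z → ⊥
  no-four-neighbours {v} {w} {x} {y} {z} v~w v~x v~y v~z w≢x w≢y w≢z x≢y x≢z y≢z =
    <-irrefl refl (≤-trans (unique-⊆⇒≤ distinct neighbours) (subcubic v))
    where
    distinct : Unique (w ∷ x ∷ y ∷ z ∷ [])
    distinct = (w≢x ∷ w≢y ∷ w≢z ∷ []) ∷ (x≢y ∷ x≢z ∷ []) ∷ (y≢z ∷ []) ∷ [] ∷ []

    neighbourhood : Vec (Fin n) (degree G v)
    neighbourhood = fromList (filter (λ u → adj G v u Bool.≟ true) (allFinL n))

    neighbour : ∀ {u} → v ~ u → u ∈ neighbourhood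
    neighbour v~u = ∈-fromList⁺ (∈-filter⁺ (λ u → adj G v u Bool.≟ true) (∈-allFin _) (Equivalence.to T-≡ v~u))

    neighbours : ∀ {u} → u ∈ w ∷ x ∷ y ∷ z ∷ [] → u ∈ neighbourhood
    neighbours (here refl) = neighbour v~w
    neighbours (there (here refl)) = neighbour v~x
    neighbours (there (there (here refl))) = neighbour v~y
    neighbours (there (there (there (here refl)))) = neighbour v~z

  third-neighbour : ∀ {v x y z w} → v ~ x → v ~ y → v ~ z → x ≢ y → x ≢ z → y ≢ z →
    v ~ w → w ≡ x ⊎ w ≡ y ⊎ w ≡ z
  third-neighbour {x = x} {y} {z} {w} v~x v~y v~z x≢y x≢z y≢z v~w with w ≟ x | w ≟ y | w ≟ z
  ... | yes w≡x | _ | _ = inj₁ w≡x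
  ... | no _ | yes w≡y | _ = inj₂ (inj₁ w≡y)
  ... | no _ | no _ | yes w≡z = inj₂ (inj₂ w≡z)
  ... | no w≢x | no w≢y | no w≢z =
    ⊥-elim (no-four-neighbours v~w v~x v~y v~z w≢x w≢y w≢z x≢y x≢z y≢z)

  record Diamond (a b c d : Fin n) : Set where
    field
      a≢b : a ≢ b
      a≢c : a ≢ c
      a≢d : a ≢ d
      b≢c : b ≢ c
      b≢d : b ≢ d
      c≢d : c ≢ d
      a~b : a ~ b
      a~c : a ~ c
      a~d : a ~ d
      b~c : b ~ c
      b~d : b ~ d

  open Diamond

  swap-hubs : ∀ {a b c d} → Diamond a b c d → Diamond b a c d
  swap-hubs D = record
    { a≢b = ≢-sym (a≢b D) ; a≢c = b≢c D ; a≢d = b≢d D ; b≢c = a≢c D ; b≢d = a≢d D ; c≢d = c≢d D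
    ; a~b = ~-sym (a~b D) ; a~c = b~c D ; a~d = b~d D ; b~c = a~c D ; b~d = a~d D }

  swap-tips : ∀ {a b c d} → Diamond a b c d → Diamond a b d c
  swap-tips D = record
    { a≢b = a≢b D ; a≢c = a≢d D ; a≢d = a≢c D ; b≢c = b≢d D ; b≢d = b≢c D ; c≢d = ≢-sym (c≢d D)
    ; a~b = a~b D ; a~c = a~d D ; a~d = a~c D ; b~c = b~d D ; b~d = b~c D }

  diamond? : ∀ a b c d → Dec (Diamond a b c d)
  diamond? a b c d = map′
    (λ (p₁ , p₂ , p₃ , p₄ , p₅ , p₆ , e₁ , e₂ , e₃ , e₄ , e₅) → record
      { a≢b = p₁ ; a≢c = p₂ ; a≢d = p₃ ; b≢c = p₄ ; b≢d = p₅ ; c≢d = p₆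
      ; a~b = e₁ ; a~c = e₂ ; a~d = e₃ ; b~c = e₄ ; b~d = e₅ })
    (λ D → a≢b D , a≢c D , a≢d D , b≢c D , b≢d D , c≢d D , a~b D , a~c D , a~d D , b~c D , b~d D)
    (¬? (a ≟ b) ×-dec ¬? (a ≟ c) ×-dec ¬? (a ≟ d) ×-dec ¬? (b ≟ c) ×-dec ¬? (b ≟ d) ×-dec
     ¬? (c ≟ d) ×-dec a ~? b ×-dec a ~? c ×-dec a ~? d ×-dec b ~? c ×-dec b ~? d)

  hub-neighbour : ∀ {a b c d w} → Diamond a b c d → a ~ w → w ≡ b ⊎ w ≡ c ⊎ w ≡ d
  hub-neighbour D = third-neighbour (a~b D) (a~c D) (a~d D) (b≢c D) (b≢d D) (c≢d D)

  hub-edge-in-triangle : ∀ {a b c d x} → Diamond a b c d → a ~ x → ∃ λ w → a ~ w × x ~ w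
  hub-edge-in-triangle D a~x with hub-neighbour D a~x
  ... | inj₁ refl = _ , a~c D , b~c D
  ... | inj₂ (inj₁ refl) = _ , a~b D , ~-sym (b~c D)
  ... | inj₂ (inj₂ refl) = _ , a~b D , ~-sym (b~d D)

  -- The tips of a hub are listed in increasing order, so that a hub has a canonical description.
  IsHub : Fin n → Set
  IsHub a = ∃ λ b → ∃ λ c → ∃ λ d → Diamond a b c d × ¬ c ~ d × c <ᶠ d

  IsTip : Fin n → Set
  IsTip c = ∃ λ a → ∃ λ b → ∃ λ d → Diamond a b c d × ¬ c ~ d

  isHub? : ∀ v → Dec (IsHub v)
  isHub? a = any? λ b → any? λ c → any? λ d → diamond? a b c d ×-dec ¬? (c ~? d) ×-dec c <ᶠ? d

  isTip? : ∀ v → Dec (IsTip v)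
  isTip? c = any? λ a → any? λ b → any? λ d → diamond? a b c d ×-dec ¬? (c ~? d)

  module _ {a b c d} (D : Diamond a b c d) (c≁d : ¬ c ~ d) where

    diamond⇒IsHub : IsHub a
    diamond⇒IsHub with <ᶠ-cmp c d
    ... | tri< c<d _ _ = b , c , d , D , c≁d , c<d
    ... | tri≈ _ c≡d _ = contradiction c≡d (c≢d D)
    ... | tri> _ _ d<c = b , d , c , swap-tips D , c≁d ∘ ~-sym , d<c

    hub-not-adjacent-to-exit : ∀ {y} → c ~ y → y ≢ b → ¬ a ~ y
    hub-not-adjacent-to-exit c~y y≢b a~y with hub-neighbour D a~y
    ... | inj₁ y≡b = y≢b y≡b
    ... | inj₂ (inj₁ refl) = ~-irrefl c~y
    ... | inj₂ (inj₂ refl) = c≁d c~y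

    hub-tip-common-neighbour : ∀ {x} → a ~ x → c ~ x → x ≡ b
    hub-tip-common-neighbour a~x c~x with hub-neighbour D a~x
    ... | inj₁ x≡b = x≡b
    ... | inj₂ (inj₁ refl) = contradiction c~x ~-irrefl
    ... | inj₂ (inj₂ refl) = contradiction c~x c≁d

  module _ {a b c d} (D : Diamond a b c d) (c≁d : ¬ c ~ d) where

    non-hub-neighbour-of-hub : ∀ {x} → a ~ x → ¬ IsHub x → x ≡ c ⊎ x ≡ d
    non-hub-neighbour-of-hub a~x x-not-hub with hub-neighbour D a~x
    ... | inj₁ refl = contradiction (diamond⇒IsHub (swap-hubs D) c≁d) x-not-hub
    ... | inj₂ x∈cd = x∈cd

    -- If y were a hub, the edge c y would lie in a triangle, but the other neighbours a, b of c
    -- are not adjacent to y.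
    exit-not-hub : ∀ {y} → c ~ y → y ≢ a → y ≢ b → ¬ IsHub y
    exit-not-hub c~y y≢a y≢b (_ , _ , _ , E , _) with hub-edge-in-triangle E (~-sym c~y)
    ... | w , y~w , c~w
      with third-neighbour (~-sym (a~c D)) (~-sym (b~c D)) c~y (a≢b D) (≢-sym y≢a) (≢-sym y≢b) c~w
    ...   | inj₁ refl = hub-not-adjacent-to-exit D c≁d c~y y≢b (~-sym y~w)
    ...   | inj₂ (inj₁ refl) = hub-not-adjacent-to-exit (swap-hubs D) c≁d c~y y≢a (~-sym y~w)
    ...   | inj₂ (inj₂ refl) = ~-irrefl y~w

    tip-neighbour : ∀ {w} → c ~ w → w ≡ a ⊎ w ≡ b ⊎ ¬ IsHub w
    tip-neighbour {w} c~w with w ≟ a | w ≟ b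
    ... | yes w≡a | _ = inj₁ w≡a
    ... | no _ | yes w≡b = inj₂ (inj₁ w≡b)
    ... | no w≢a | no w≢b = inj₂ (inj₂ (exit-not-hub c~w w≢a w≢b))

    hubs-of-tip : ∀ {h} → c ~ h → IsHub h → h ≡ a ⊎ h ≡ b
    hubs-of-tip c~h h-hub with tip-neighbour c~h
    ... | inj₁ h≡a = inj₁ h≡a
    ... | inj₂ (inj₁ h≡b) = inj₂ h≡b
    ... | inj₂ (inj₂ h-not-hub) = contradiction h-hub h-not-hub

    tip-not-hub : ¬ IsHub c
    tip-not-hub (_ , _ , _ , E , c'≁d' , _) with hubs-of-tip (a~b E) (diamond⇒IsHub (swap-hubs E) c'≁d')
    ... | inj₁ refl = c≢d E (trans (hub-tip-common-neighbour D c≁d (b~c E) (a~c E))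
                                    (sym (hub-tip-common-neighbour D c≁d (b~d E) (a~d E))))
    ... | inj₂ refl = c≢d E (trans (hub-tip-common-neighbour (swap-hubs D) c≁d (b~c E) (a~c E))
                                   (sym (hub-tip-common-neighbour (swap-hubs D) c≁d (b~d E) (a~d E))))

    exit-unique : ∀ {y z} → c ~ y → ¬ IsHub y → c ~ z → ¬ IsHub z → z ≡ y
    exit-unique {y} c~y y-not-hub c~z z-not-hub with
      third-neighbour (~-sym (a~c D)) (~-sym (b~c D)) c~y (a≢b D) a≢y b≢y c~z
      where
      a≢y : a ≢ y
      a≢y refl = y-not-hub (diamond⇒IsHub D c≁d)
      b≢y : b ≢ y
      b≢y refl = y-not-hub (diamond⇒IsHub (swap-hubs D) c≁d)
    ... | inj₁ refl = contradiction (diamond⇒IsHub D c≁d) z-not-hub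
    ... | inj₂ (inj₁ refl) = contradiction (diamond⇒IsHub (swap-hubs D) c≁d) z-not-hub
    ... | inj₂ (inj₂ z≡y) = z≡y

  module _ {a b c d} (D : Diamond a b c d) (c≁d : ¬ c ~ d) where

    non-hub-neighbour-of-hubs : ∀ {h x} → h ≡ a ⊎ h ≡ b → h ~ x → ¬ IsHub x → x ≡ c ⊎ x ≡ d
    non-hub-neighbour-of-hubs (inj₁ refl) = non-hub-neighbour-of-hub D c≁d
    non-hub-neighbour-of-hubs (inj₂ refl) = non-hub-neighbour-of-hub (swap-hubs D) c≁d

    mate-unique : ∀ {a' b' s'} → Diamond a' b' c s' → ¬ c ~ s' → s' ≡ d
    mate-unique D' c≁s' with non-hub-neighbour-of-hubs
      (hubs-of-tip D c≁d (~-sym (a~c D')) (diamond⇒IsHub D' c≁s')) (a~d D')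
      (tip-not-hub (swap-tips D') (c≁s' ∘ ~-sym))
    ... | inj₁ refl = contradiction refl (c≢d D')
    ... | inj₂ s'≡d = s'≡d

    hub-unique : c <ᶠ d → ∀ {b' c' d'} → Diamond a b' c' d' → ¬ c' ~ d' → c' <ᶠ d' →
      b' ≡ b × c' ≡ c × d' ≡ d
    hub-unique c<d E c'≁d' c'<d' with hub-neighbour D (a~b E)
      | non-hub-neighbour-of-hub D c≁d (a~c E) (tip-not-hub E c'≁d')
      | non-hub-neighbour-of-hub D c≁d (a~d E) (tip-not-hub (swap-tips E) (c'≁d' ∘ ~-sym))
    ... | inj₂ (inj₁ refl) | _ | _ = contradiction (diamond⇒IsHub (swap-hubs E) c'≁d') (tip-not-hub D c≁d)
    ... | inj₂ (inj₂ refl) | _ | _ =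
      contradiction (diamond⇒IsHub (swap-hubs E) c'≁d') (tip-not-hub (swap-tips D) (c≁d ∘ ~-sym))
    ... | inj₁ refl | inj₁ refl | inj₂ refl = refl , refl , refl
    ... | inj₁ refl | inj₁ refl | inj₁ refl = contradiction refl (c≢d E)
    ... | inj₁ refl | inj₂ refl | inj₂ refl = contradiction refl (c≢d E)
    ... | inj₁ refl | inj₂ refl | inj₁ refl = ⊥-elim (<ᶠ-asym c<d c'<d')

  -- For an induced diamond, the exits of c and d are exactly their neighbours outside it.
  Exit : Fin n → Fin n → Fin n → Set
  Exit c d y = (c ~ y ⊎ d ~ y) × ¬ IsHub y

  exit? : ∀ c d → Dec (∃ (Exit c d))
  exit? c d = any? λ y → (c ~? y ⊎-dec d ~? y) ×-dec ¬? (isHub? y)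

  exitOf : Fin n → Fin n → Fin n
  exitOf c d with exit? c d
  ... | yes (y , _) = y
  ... | no _ = c

  exitOf-exit : ∀ {c d} → ∃ (Exit c d) → Exit c d (exitOf c d)
  exitOf-exit {c} {d} has-exit with exit? c d
  ... | yes (_ , y-exit) = y-exit
  ... | no no-exit = contradiction has-exit no-exit

  exit : Fin n → Fin n
  exit v = exitOf v v

  exit-of-tip : ∀ {a b c d y} → Diamond a b c d → ¬ c ~ d → c ~ y → ¬ IsHub y → exit c ≡ y
  exit-of-tip D c≁d c~y y-not-hub =
    let c~w , w-not-hub = exitOf-exit (_ , inj₁ c~y , y-not-hub)
    in exit-unique D c≁d c~y y-not-hub (Sum.reduce c~w) w-not-hub

  mate : Fin n → Fin n
  mate c with isTip? c
  ... | yes (_ , _ , d , _) = d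
  ... | no _ = c

  mate-tip : ∀ {a b c d} → Diamond a b c d → ¬ c ~ d → mate c ≡ d
  mate-tip {c = c} D c≁d with isTip? c
  ... | yes (_ , _ , _ , D' , c≁s') = mate-unique D c≁d D' c≁s'
  ... | no not-tip = contradiction (_ , _ , _ , D , c≁d) not-tip

  -- Colouring the diamonds

  data Role : Set where
    hub : (b c d : Fin n) → Role
    tip other : Role

  role : Fin n → Role
  role v with isHub? v | isTip? v
  ... | yes (b , c , d , _) | _ = hub b c d
  ... | no _ | yes _ = tip
  ... | no _ | no _ = other

  role-hub : ∀ {a b c d} → Diamond a b c d → ¬ c ~ d → c <ᶠ d → role a ≡ hub b c d
  role-hub {a} D c≁d c<d with isHub? a
  ... | no not-hub = contradiction (diamond⇒IsHub D c≁d) not-hub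
  ... | yes (_ , _ , _ , E , c'≁d' , c'<d') with hub-unique D c≁d c<d E c'≁d' c'<d'
  ...   | refl , refl , refl = refl

  role-tip : ∀ {a b c d} → Diamond a b c d → ¬ c ~ d → role c ≡ tip
  role-tip {c = c} D c≁d with isHub? c | isTip? c
  ... | yes c-hub | _ = contradiction c-hub (tip-not-hub D c≁d)
  ... | no _ | yes _ = refl
  ... | no _ | no not-tip = contradiction (_ , _ , _ , D , c≁d) not-tip

  role-other : ∀ {v} → ¬ IsHub v → ¬ IsTip v → role v ≡ other
  role-other {v} not-hub not-tip with isHub? v | isTip? v
  ... | yes v-hub | _ = contradiction v-hub not-hub
  ... | no _ | yes v-tip = contradiction v-tip not-tip
  ... | no _ | no _ = refl

  level : Role → Fin 3
  level (hub _ _ _) = 2F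
  level tip = 1F
  level other = 0F

  level-non-hub : ∀ {v} → ¬ IsHub v → toℕ (level (role v)) < 2
  level-non-hub {v} not-hub with isHub? v | isTip? v
  ... | yes v-hub | _ = contradiction v-hub not-hub
  ... | no _ | yes _ = s≤s (s≤s z≤n)
  ... | no _ | no _ = s≤s z≤n

  -- rank v = n * level v + v, so vertices are ordered by level first.
  rank : Fin n → ℕ
  rank v = toℕ (combine (level (role v)) v)

  rank-injective : ∀ {u v} → rank u ≡ rank v → u ≡ v
  rank-injective {u} {v} same = combine-injectiveʳ (level (role u)) u (level (role v)) v (toℕ-injective same)

  rank-mono : ∀ {u v} → level (role u) <ᶠ level (role v) → rank u < rank v
  rank-mono {u} {v} = combine-monoˡ-< u v

  -- Both hubs of a diamond see the same sorted tips c, d, hence avoid the same exit exitOf c d.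
  -- The list of a vertex on no diamond imposes nothing: a vertex never has smaller rank than itself.
  roleConflicts : Fin n → Role → Vec (Fin n) 4
  roleConflicts _ (hub b c d) = c ∷ d ∷ exitOf c d ∷ b ∷ []
  roleConflicts p tip = mate p ∷ exit p ∷ exit (mate p) ∷ mate (exit p) ∷ []
  roleConflicts v other = v ∷ v ∷ v ∷ v ∷ []

  conflicts : Fin n → Vec (Fin n) 4
  conflicts v = roleConflicts v (role v)

  open GreedyColouring rank conflicts public

  conflicts-hub : ∀ {a b c d} → Diamond a b c d → ¬ c ~ d → c <ᶠ d →
    conflicts a ≡ c ∷ d ∷ exitOf c d ∷ b ∷ []
  conflicts-hub D c≁d c<d = cong (roleConflicts _) (role-hub D c≁d c<d)

  conflicts-tip : ∀ {a b c d} → Diamond a b c d → ¬ c ~ d →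
    conflicts c ≡ d ∷ exit c ∷ exit d ∷ mate (exit c) ∷ []
  conflicts-tip {c = c} {d} D c≁d = begin
    conflicts c
      ≡⟨ cong (roleConflicts c) (role-tip D c≁d) ⟩
    mate c ∷ exit c ∷ exit (mate c) ∷ mate (exit c) ∷ []
      ≡⟨ cong (λ m → m ∷ exit c ∷ exit m ∷ mate (exit c) ∷ []) (mate-tip D c≁d) ⟩
    d ∷ exit c ∷ exit d ∷ mate (exit c) ∷ [] ∎
    where open ≡-Reasoning

  rank-hub : ∀ {a b c d u} → Diamond a b c d → ¬ c ~ d → c <ᶠ d → ¬ IsHub u → rank u < rank a
  rank-hub {u = u} D c≁d c<d u-not-hub =
    rank-mono (subst (λ r → toℕ (level (role u)) < toℕ (level r))
                     (sym (role-hub D c≁d c<d)) (level-non-hub u-not-hub))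

  rank-tip : ∀ {a b c d u} → Diamond a b c d → ¬ c ~ d → ¬ IsHub u → ¬ IsTip u → rank u < rank c
  rank-tip D c≁d u-not-hub u-not-tip = rank-mono
    (subst₂ (λ r s → toℕ (level r) < toℕ (level s))
            (sym (role-other u-not-hub u-not-tip)) (sym (role-tip D c≁d)) (s≤s z≤n))

  tips-coloured-apart : ∀ {a b c d} → Diamond a b c d → ¬ c ~ d → colour c ≢ colour d
  tips-coloured-apart D c≁d = colour-separates
    (subst (_ ∈_) (sym (conflicts-tip (swap-tips D) (c≁d ∘ ~-sym))) (here refl))
    (subst (_ ∈_) (sym (conflicts-tip D c≁d)) (here refl))
    (c≢d D ∘ rank-injective)

  module _ {a b c d y} (D : Diamond a b c d) (c≁d : ¬ c ~ d) (c~y : c ~ y) (y-not-hub : ¬ IsHub y) where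

    private
      c-exit : exit c ≡ y
      c-exit = exit-of-tip D c≁d c~y y-not-hub

      y∈c : y ∈ conflicts c
      y∈c = subst (y ∈_) (sym (conflicts-tip D c≁d)) (there (here (sym c-exit)))

      y∈d : y ∈ conflicts d
      y∈d = subst (y ∈_) (sym (conflicts-tip (swap-tips D) (c≁d ∘ ~-sym))) (there (there (here (sym c-exit))))

      y≢d : y ≢ d
      y≢d refl = c≁d c~y

    -- A tip y is not below c and d in rank, but its own list contains exit y = c and mate c = d.
    exit-coloured-apart : colour y ≢ colour c × colour y ≢ colour d
    exit-coloured-apart = by-role (isTip? y)
      where
      by-role : Dec (IsTip y) → colour y ≢ colour c × colour y ≢ colour d
      by-role (yes (_ , _ , _ , E , y≁t)) =
        colour-separates y∈c (subst (c ∈_) (sym (conflicts-tip E y≁t)) (there (here (sym y-exit))))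
          (≢-sym (~⇒≢ c~y) ∘ rank-injective) ,
        colour-separates y∈d (subst (d ∈_) (sym (conflicts-tip E y≁t))
          (there (there (there (here (sym (trans (cong mate y-exit) (mate-tip D c≁d))))))))
          (y≢d ∘ rank-injective)
        where
        y-exit : exit y ≡ c
        y-exit = exit-of-tip E y≁t (~-sym c~y) (tip-not-hub D c≁d)
      by-role (no y-not-tip) =
        colour-proper y∈c (rank-tip D c≁d y-not-hub y-not-tip) ,
        colour-proper y∈d (rank-tip (swap-tips D) (c≁d ∘ ~-sym) y-not-hub y-not-tip)

  Dominates : Fin n → Fin n → Set
  Dominates v x = v ≡ x ⊎ v ~ x

  module _ {a b c d} (D : Diamond a b c d) (c≁d : ¬ c ~ d) (c<d : c <ᶠ d) (has-exit : ∃ (Exit c d)) where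

    private
      w : Fin n
      w = exitOf c d

      w-exit : Exit c d w
      w-exit = exitOf-exit has-exit

      exit-apart : ∀ {y} → Exit c d y → colour y ≢ colour c × colour y ≢ colour d
      exit-apart (inj₁ c~y , y-not-hub) = exit-coloured-apart D c≁d c~y y-not-hub
      exit-apart (inj₂ d~y , y-not-hub) = swap (exit-coloured-apart (swap-tips D) (c≁d ∘ ~-sym) d~y y-not-hub)

      avoided-by-hub : ∀ {h h'} → Diamond h h' c d →
        colour c ≢ colour h × colour d ≢ colour h × colour w ≢ colour h
      avoided-by-hub {h} {h'} H =
        below (here refl) (tip-not-hub H c≁d) ,
        below (there (here refl)) (tip-not-hub (swap-tips H) (c≁d ∘ ~-sym)) ,
        below (there (there (here refl))) (proj₂ w-exit)
        where
        below : ∀ {x} → x ∈ c ∷ d ∷ w ∷ h' ∷ [] → ¬ IsHub x → colour x ≢ colour h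
        below x∈ x-not-hub =
          colour-proper (subst (_ ∈_) (sym (conflicts-hub H c≁d c<d)) x∈) (rank-hub H c≁d c<d x-not-hub)

      hubs-apart : colour a ≢ colour b
      hubs-apart = colour-separates
        (subst (a ∈_) (sym (conflicts-hub (swap-hubs D) c≁d c<d)) (there (there (there (here refl)))))
        (subst (b ∈_) (sym (conflicts-hub D c≁d c<d)) (there (there (there (here refl)))))
        (a≢b D ∘ rank-injective)

    five-colours : Unique (map colour (c ∷ d ∷ w ∷ a ∷ b ∷ []))
    five-colours =
      let w≢c , w≢d = exit-apart w-exit
          c≢a , d≢a , w≢a = avoided-by-hub D
          c≢b , d≢b , w≢b = avoided-by-hub (swap-hubs D)
      in (tips-coloured-apart D c≁d ∷ ≢-sym w≢c ∷ c≢a ∷ c≢b ∷ []) ∷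
         (≢-sym w≢d ∷ d≢a ∷ d≢b ∷ []) ∷ (w≢a ∷ w≢b ∷ []) ∷ (hubs-apart ∷ []) ∷ [] ∷ []

    every-colour-near-sorted : ∀ i → ∃ λ v → colour v ≡ i × (Dominates v c ⊎ Dominates v d)
    every-colour-near-sorted i = near (Any.map⁻ {f = colour} (unique-complete five-colours i))
      where
      near : Any ((i ≡_) ∘ colour) (c ∷ d ∷ w ∷ a ∷ b ∷ []) →
        ∃ λ v → colour v ≡ i × (Dominates v c ⊎ Dominates v d)
      near (here i≡) = c , sym i≡ , inj₁ (inj₁ refl)
      near (there (here i≡)) = d , sym i≡ , inj₂ (inj₁ refl)
      near (there (there (here i≡))) = w , sym i≡ , Sum.map (inj₂ ∘ ~-sym) (inj₂ ∘ ~-sym) (proj₁ w-exit)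
      near (there (there (there (here i≡)))) = a , sym i≡ , inj₁ (inj₂ (a~c D))
      near (there (there (there (there (here i≡))))) = b , sym i≡ , inj₁ (inj₂ (b~c D))

  every-colour-near : ∀ {a b c d} → Diamond a b c d → ¬ c ~ d → ∃ (Exit c d) →
    ∀ i → ∃ λ v → colour v ≡ i × (Dominates v c ⊎ Dominates v d)
  every-colour-near {c = c} {d} D c≁d has-exit i = by-order (<ᶠ-cmp c d)
    where
    by-order : Tri (c <ᶠ d) (c ≡ d) (d <ᶠ c) → ∃ λ v → colour v ≡ i × (Dominates v c ⊎ Dominates v d)
    by-order (tri< c<d _ _) = every-colour-near-sorted D c≁d c<d has-exit i
    by-order (tri≈ _ c≡d _) = contradiction c≡d (c≢d D)
    by-order (tri> _ _ d<c) =
      Product.map₂ (Product.map₂ Sum.swap)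
        (every-colour-near-sorted (swap-tips D) (c≁d ∘ ~-sym) d<c
          (Product.map₂ (Product.map₁ Sum.swap) has-exit) i)

  -- Diamonds that are whole components

  closed-under-walks : (P : Fin n → Set) → (∀ {u w} → P u → u ~ w → P w) →
    ∀ {u v} → Walk G u v → P u → P v
  closed-under-walks P closed here Pu = Pu
  closed-under-walks P closed (step u~w walk) Pu = closed-under-walks P closed walk (closed Pu u~w)

  module _ {a b c d} (D : Diamond a b c d) where

    corner : Fin 4 → Fin n
    corner = lookup (a ∷ b ∷ c ∷ d ∷ [])

    IsCorner : Fin n → Set
    IsCorner v = v ∈ a ∷ b ∷ c ∷ d ∷ []

    corners-unique : Unique (a ∷ b ∷ c ∷ d ∷ [])
    corners-unique = (a≢b D ∷ a≢c D ∷ a≢d D ∷ []) ∷ (b≢c D ∷ b≢d D ∷ []) ∷ (c≢d D ∷ []) ∷ [] ∷ []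

    all-corners : (∀ u v → Walk G u v) →
      (∀ {w} → c ~ w → IsCorner w) → (∀ {w} → d ~ w → IsCorner w) → ∀ v → IsCorner v
    all-corners walk c-enclosed d-enclosed v = closed-under-walks IsCorner closed (walk a v) (here refl)
      where
      closed : ∀ {u w} → IsCorner u → u ~ w → IsCorner w
      closed (here refl) u~w =
        Sum.[ there ∘ here , Sum.[ there ∘ there ∘ here , there ∘ there ∘ there ∘ here ]′ ]′
          (hub-neighbour D u~w)
      closed (there (here refl)) u~w =
        Sum.[ here , Sum.[ there ∘ there ∘ here , there ∘ there ∘ there ∘ here ]′ ]′
          (hub-neighbour (swap-hubs D) u~w)
      closed (there (there (here refl))) u~w = c-enclosed u~w
      closed (there (there (there (here refl)))) u~w = d-enclosed u~w

    corner-table : (H : Graph 4) → adj G c d ≡ adj H 2F 3F →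
      T (adj H 0F 1F) → T (adj H 0F 2F) → T (adj H 0F 3F) → T (adj H 1F 2F) → T (adj H 1F 3F) →
      ∀ i j → adj G (corner i) (corner j) ≡ adj H i j
    corner-table H cd-agrees h01 h02 h03 h12 h13 = table
      where
      edge : ∀ {x y i j} → x ~ y → T (adj H i j) → adj G x y ≡ adj H i j
      edge x~y h = trans (Equivalence.to T-≡ x~y) (sym (Equivalence.to T-≡ h))

      diagonal : ∀ x i → adj G x x ≡ adj H i i
      diagonal x i = trans (irref G x) (sym (irref H i))

      flipped : ∀ i j → adj G (corner j) (corner i) ≡ adj H j i →
        adj G (corner i) (corner j) ≡ adj H i j
      flipped i j e = trans (Graph.sym G _ _) (trans e (Graph.sym H j i))

      table : ∀ i j → adj G (corner i) (corner j) ≡ adj H i j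
      table 0F 0F = diagonal a 0F
      table 0F 1F = edge (a~b D) h01
      table 0F 2F = edge (a~c D) h02
      table 0F 3F = edge (a~d D) h03
      table 1F 0F = flipped 1F 0F (table 0F 1F)
      table 1F 1F = diagonal b 1F
      table 1F 2F = edge (b~c D) h12
      table 1F 3F = edge (b~d D) h13
      table 2F 0F = flipped 2F 0F (table 0F 2F)
      table 2F 1F = flipped 2F 1F (table 1F 2F)
      table 2F 2F = diagonal c 2F
      table 2F 3F = cd-agrees
      table 3F 0F = flipped 3F 0F (table 0F 3F)
      table 3F 1F = flipped 3F 1F (table 1F 3F)
      table 3F 2F = flipped 3F 2F (table 2F 3F)
      table 3F 3F = diagonal d 3F

    ≅-from-table : (H : Graph 4) → (complete : ∀ v → IsCorner v) →
      (∀ i j → adj G (corner i) (corner j) ≡ adj H i j) → G ≅ H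
    ≅-from-table H complete table = record
      { iso = enumeration-↔ corners-unique complete
      ; preserve = λ u v →
          trans (cong₂ (adj G) (lookup-index (complete u)) (lookup-index (complete v))) (table _ _)
      }

  no-exit⇒≅B₂ : ∀ {a b c d} → (∀ u v → Walk G u v) → Diamond a b c d → ¬ c ~ d → ¬ ∃ (Exit c d) →
    G ≅ B₂
  no-exit⇒≅B₂ {a} {b} {c} {d} walk D c≁d no-exit = ≅-from-table D B₂
    (all-corners D walk
      (λ c~w → hub-corner (tip-neighbour D c≁d c~w) (λ w-not-hub → no-exit (_ , inj₁ c~w , w-not-hub)))
      (λ d~w → hub-corner (tip-neighbour (swap-tips D) (c≁d ∘ ~-sym) d~w)
                          (λ w-not-hub → no-exit (_ , inj₂ d~w , w-not-hub))))
    (corner-table D B₂ (dec-false (c ~? d) c≁d) _ _ _ _ _)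
    where
    hub-corner : ∀ {w} → w ≡ a ⊎ w ≡ b ⊎ ¬ IsHub w → ¬ ¬ IsHub w → IsCorner D w
    hub-corner (inj₁ refl) _ = here refl
    hub-corner (inj₂ (inj₁ refl)) _ = there (here refl)
    hub-corner (inj₂ (inj₂ w-not-hub)) w-hub = contradiction w-not-hub w-hub

  tips-adjacent⇒≅K₄ : ∀ {a b c d} → (∀ u v → Walk G u v) → Diamond a b c d → c ~ d → G ≅ K₄
  tips-adjacent⇒≅K₄ walk D c~d = ≅-from-table D K₄
    (all-corners D walk
      (Sum.[ here , Sum.[ there ∘ here , there ∘ there ∘ there ∘ here ]′ ]′ ∘
        third-neighbour (~-sym (a~c D)) (~-sym (b~c D)) c~d (a≢b D) (a≢d D) (b≢d D))
      (Sum.[ here , Sum.[ there ∘ here , there ∘ there ∘ here ]′ ]′ ∘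
        third-neighbour (~-sym (a~d D)) (~-sym (b~d D)) (~-sym c~d) (a≢b D) (a≢c D) (b≢c D)))
    (corner-table D K₄ (dec-true (_ ~? _) c~d) _ _ _ _ _)

  colourClass-isolating : (∀ u v → Walk G u v) → ¬ (G ≅ B₂) → ¬ (G ≅ K₄) →
    ∀ i → IsB₂Isolating G (colourClass colour i)
  colourClass-isolating walk G≇B₂ G≇K₄ i
    (a , b , c , d , a≢b , a≢c , a≢d , b≢c , b≢d , c≢d , _ , _ , c-free , d-free , a~b , a~c , a~d , b~c , b~d)
    = isolated (c ~? d) (exit? c d)
    where
    D : Diamond a b c d
    D = record { a≢b = a≢b ; a≢c = a≢c ; a≢d = a≢d ; b≢c = b≢c ; b≢d = b≢d ; c≢d = c≢d
               ; a~b = a~b ; a~c = a~c ; a~d = a~d ; b~c = b~c ; b~d = b~d }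

    dominated : ∀ {v x} → colour v ≡ i → Dominates v x → InClosedNbhd G (colourClass colour i) x
    dominated v-coloured (inj₁ refl) = inj₁ (∈-colourClass {col = colour} v-coloured)
    dominated v-coloured (inj₂ v~x) = inj₂ (_ , ∈-colourClass {col = colour} v-coloured , v~x)

    tip-dominated : (∃ λ v → colour v ≡ i × (Dominates v c ⊎ Dominates v d)) → ⊥
    tip-dominated (_ , v-coloured , inj₁ dominates-c) = c-free (dominated v-coloured dominates-c)
    tip-dominated (_ , v-coloured , inj₂ dominates-d) = d-free (dominated v-coloured dominates-d)

    isolated : Dec (c ~ d) → Dec (∃ (Exit c d)) → ⊥
    isolated (yes c~d) _ = G≇K₄ (tips-adjacent⇒≅K₄ walk D c~d)
    isolated (no c≁d) (no no-exit) = G≇B₂ (no-exit⇒≅B₂ walk D c≁d no-exit)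
    isolated (no c≁d) (yes has-exit) = tip-dominated (every-colour-near D c≁d has-exit i)

lemma2p6 : (n : ℕ) (G : Graph n) → Connected G → MaxDegree3 G →
    ¬ (G ≅ B₂) → ¬ (G ≅ K₄) →
    Σ (Subset n) (λ S → IsB₂Isolating G S × 5 * ∣ S ∣ ≤ n)
lemma2p6 n G (_ , walk) (subcubic , _) G≇B₂ G≇K₄ =
  let i , small = smallest-colourClass colour
  in colourClass colour i , colourClass-isolating walk G≇B₂ G≇K₄ i , small
  where open Subcubic G subcubic
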